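{- Let $\mathcal{F}$ be a finite union-closed family of sets with $\emptyset\notin\mathcal{F}$ and $n=|\bigcup_{A\in\mathcal{F}}A|$. If the height number satisfies $H(\mathcal{F})\ge n-1$, then there exists an element $x$ which belongs to more than half of the sets of $\mathcal{F}$.
   Context: A union-closed family is a finite family $\mathcal{F}$ of finite sets closed under pairwise union. Height decomposition: $\pi_1$ is the set of inclusion-minimal members of $\mathcal{F}$; inductively, while $\mathcal{F}\setminus(\pi_1\cup\dots\cup\pi_{i-1})\neq\emptyset$, $\pi_i$ is the set of inclusion-minimal members of $\mathcal{F}\setminus(\pi_1\cup\dots\cup\pi_{i-1})$; the number of steps until $\mathcal{F}$ is exhausted is the height number $H(\mathcal{F})$. -}

module Defs where

open import Data.Nat using (ℕ; zero; suc)
open import Data.Fin using (Fin)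
open import Data.Fin.Subset using (Subset; _⊂_; _∪_; _∈_)
open import Data.Fin.Subset.Properties using (_⊂?_; _∈?_)
open import Data.List using (List; []; _∷_; filter; length)
open import Data.List.Relation.Unary.Any using (any?)
open import Data.List.Membership.Propositional renaming (_∈_ to _∈ₗ_)

UnionClosed : ∀ {m} → List (Subset m) → Set
UnionClosed F = ∀ {A B} → A ∈ₗ F → B ∈ₗ F → (A ∪ B) ∈ₗ F

removeMinimal : ∀ {m} → List (Subset m) → List (Subset m)
removeMinimal F = filter (λ A → any? (λ B → B ⊂? A) F) F

heightAux : ∀ {m} → ℕ → List (Subset m) → ℕ
heightAux zero       _       = zero
heightAux (suc fuel) []      = zero
heightAux (suc fuel) (A ∷ F) = suc (heightAux fuel (removeMinimal (A ∷ F)))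

-- Height number H(F).  Each step removes at least one member (a nonempty
-- finite family has a minimal member), so |F| steps suffice.
height : ∀ {m} → List (Subset m) → ℕ
height F = heightAux (length F) F

degree : ∀ {m} → Fin m → List (Subset m) → ℕ
degree x F = length (filter (λ A → x ∈? A) F)

-- A family of height at least n − 1 has a member with at most two elements:
-- each member of πᵢ₊₁ strictly contains a member of πᵢ, so if all members had
-- three or more elements, those of πᵢ would have at least i + 2 and the height
-- would be at most n − 2.  For a member S ⊆ {x, y}, the map A ↦ A ∪ S sends the members
-- avoiding S injectively to members containing S other than S itself, so
-- fewer members avoid both x and y than contain both; by inclusion–exclusion
-- deg x + deg y > |F|, and the larger of the two degrees exceeds |F| / 2.
module Submission where

open import Defs
open import Data.Nat using (ℕ; _*_; _<_; _≤_; _∸_)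
open import Data.Fin using (Fin)
open import Data.Fin.Subset using (Subset; ⊥; ⋃; ∣_∣)
open import Data.List using (List; []; length)
open import Data.List.Relation.Unary.Unique.Propositional using (Unique)
open import Data.List.Membership.Propositional using (_∉_)
open import Data.Product using (∃)
open import Relation.Binary.PropositionalEquality using (_≢_)

open import Data.Nat using (zero; suc; _+_; z≤n; s≤s; _≤?_)
open import Data.Nat.Properties
open import Data.Bool.Properties using () renaming (_≟_ to _≟ᵇ_)
open import Data.Vec.Properties using (≡-dec)
open import Data.Fin using () renaming (_≟_ to _≟ᶠ_)
open import Data.Fin.Subset using (_⊆_; _⊂_; _∪_; _-_; Nonempty)
  renaming (_∈_ to _∈ˢ_; _∉_ to _∉ˢ_)
open import Data.Fin.Subset.Properties
open import Data.List using (_∷_; filter; map)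
open import Data.List.Properties using (filter-notAll; length-map)
open import Data.List.Membership.Propositional using (_∈_; find)
open import Data.List.Membership.Propositional.Properties using (∈-filter⁺; ∈-filter⁻; ∈-map⁻)
open import Data.List.Relation.Binary.Subset.Propositional using () renaming (_⊆_ to _⊆ₗ_)
open import Data.List.Relation.Unary.Any as Any using (here; there; any?)
open import Data.List.Relation.Unary.All as All using (All)
open import Data.List.Relation.Unary.All.Properties using (¬Any⇒All¬) renaming (map⁺ to All-map⁺)
open import Data.List.Relation.Unary.AllPairs using ([]; _∷_)
import Data.List.Relation.Unary.Unique.Propositional.Properties as Unique
open import Data.Product using (_×_; _,_; proj₁; proj₂) renaming (map₂ to ×-map₂)
open import Data.Sum using (_⊎_; inj₁; inj₂; [_,_]′)
open import Relation.Nullary using (¬_; yes; no; ¬?; _×-dec_; contradiction)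
open import Relation.Nullary.Decidable using (decidable-stable)
open import Relation.Unary using (Pred; Decidable)
open import Relation.Binary.Definitions using (DecidableEquality)
open import Function using (_∘_)
open import Relation.Binary.PropositionalEquality using (_≡_; refl; sym; trans; cong; subst)

module _ {a} {A : Set a} where

  unique-⊆⇒length-≤ : DecidableEquality A → ∀ {xs ys : List A} →
                      Unique xs → xs ⊆ₗ ys → length xs ≤ length ys
  unique-⊆⇒length-≤ _≟_ {[]} _ _ = z≤n
  unique-⊆⇒length-≤ _≟_ {x ∷ xs} {ys} (x∉xs ∷ xs!) xs⊆ys = begin-strict
    length xs               ≤⟨ unique-⊆⇒length-≤ _≟_ xs! xs⊆others ⟩
    length (filter ≢x? ys)  <⟨ filter-notAll ≢x? ys (Any.map (λ x≡y x≢y → x≢y x≡y) (xs⊆ys (here refl))) ⟩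
    length ys               ∎
    where
    open ≤-Reasoning
    ≢x? : Decidable (x ≢_)
    ≢x? y = ¬? (x ≟ y)
    xs⊆others : xs ⊆ₗ filter ≢x? ys
    xs⊆others y∈xs = ∈-filter⁺ ≢x? (xs⊆ys (there y∈xs)) (All.lookup x∉xs y∈xs)

  unique-map⁺ : ∀ {b} {B : Set b} (f : A → B) {xs : List A} →
                (∀ {x y} → x ∈ xs → y ∈ xs → f x ≡ f y → x ≡ y) →
                Unique xs → Unique (map f xs)
  unique-map⁺ f {[]} _ _ = []
  unique-map⁺ f {x ∷ xs} injective (x∉xs ∷ xs!) =
    All-map⁺ (All.tabulate λ y∈xs fx≡fy → All.lookup x∉xs y∈xs (injective (here refl) (there y∈xs) fx≡fy))
      ∷ unique-map⁺ f (λ x∈ y∈ → injective (there x∈) (there y∈)) xs!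

+-suc-middle : ∀ k l {m n} → k + l + m ≡ n → k + suc l + m ≡ suc n
+-suc-middle k l {m} eq = trans (cong (_+ m) (+-suc k l)) (cong suc eq)

module _ {a p q} {A : Set a} {P : Pred A p} {Q : Pred A q} (P? : Decidable P) (Q? : Decidable Q) where

  both? : Decidable (λ z → P z × Q z)
  both? z = P? z ×-dec Q? z

  neither? : Decidable (λ z → ¬ P z × ¬ Q z)
  neither? z = ¬? (P? z) ×-dec ¬? (Q? z)

  length-filter-inclusion-exclusion : ∀ xs →
    length (filter P? xs) + length (filter Q? xs) + length (filter neither? xs)
      ≡ length xs + length (filter both? xs)
  length-filter-inclusion-exclusion [] = refl
  length-filter-inclusion-exclusion (x ∷ xs) with P? x | Q? x | length-filter-inclusion-exclusion xs
  ... | yes _ | yes _ | ih =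
    cong suc (trans (+-suc-middle (length (filter P? xs)) (length (filter Q? xs)) ih) (sym (+-suc (length xs) _)))
  ... | yes _ | no  _ | ih = cong suc ih
  ... | no  _ | yes _ | ih = +-suc-middle (length (filter P? xs)) (length (filter Q? xs)) ih
  ... | no  _ | no  _ | ih = trans (+-suc (length (filter P? xs) + length (filter Q? xs)) _) (cong suc ih)

0<n≤m∸2⇒n<m∸1 : ∀ {m n} → 0 < n → n ≤ m ∸ 2 → n < m ∸ 1
0<n≤m∸2⇒n<m∸1 {zero}        0<n n≤0 = contradiction n≤0 (<⇒≱ 0<n)
0<n≤m∸2⇒n<m∸1 {suc zero}    0<n n≤0 = contradiction n≤0 (<⇒≱ 0<n)
0<n≤m∸2⇒n<m∸1 {suc (suc m)} _   n≤m = s≤s n≤m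

m+n≡o+p⇒n<p⇒o<m : ∀ {m n o p} → m + n ≡ o + p → n < p → o < m
m+n≡o+p⇒n<p⇒o<m {m} {n} {o} {p} eq n<p = +-cancelʳ-< p o m (begin-strict
  o + p  ≡⟨ eq ⟨
  m + n  <⟨ +-monoʳ-< m n<p ⟩
  m + p  ∎)
  where open ≤-Reasoning

<+⇒<2*⊎<2* : ∀ {n} a b → n < a + b → n < 2 * a ⊎ n < 2 * b
<+⇒<2*⊎<2* {n} a b n<a+b with ≤-total b a
... | inj₁ b≤a = inj₁ (<-≤-trans n<a+b (begin
  a + b        ≤⟨ +-monoʳ-≤ a b≤a ⟩
  a + a        ≡⟨ cong (a +_) (+-identityʳ a) ⟨
  2 * a        ∎))
  where open ≤-Reasoning
... | inj₂ a≤b = inj₂ (<-≤-trans n<a+b (begin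
  a + b        ≤⟨ +-monoˡ-≤ b a≤b ⟩
  b + b        ≡⟨ cong (b +_) (+-identityʳ b) ⟨
  2 * b        ∎))
  where open ≤-Reasoning

module _ {m : ℕ} where

  Disjoint : Subset m → Subset m → Set
  Disjoint A B = ∀ {z} → z ∈ˢ A → z ∉ˢ B

  ∪-disjoint-⊆ : ∀ {A B S} → Disjoint A S → A ∪ S ⊆ B ∪ S → A ⊆ B
  ∪-disjoint-⊆ {A} {B} {S} A#S A∪S⊆B∪S {z} z∈A with x∈p∪q⁻ B S (A∪S⊆B∪S (p⊆p∪q S z∈A))
  ... | inj₁ z∈B = z∈B
  ... | inj₂ z∈S = contradiction z∈S (A#S z∈A)

  ∪-cancelʳ-disjoint : ∀ {A B S} → Disjoint A S → Disjoint B S → A ∪ S ≡ B ∪ S → A ≡ B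
  ∪-cancelʳ-disjoint A#S B#S eq =
    ⊆-antisym (∪-disjoint-⊆ A#S (⊆-reflexive eq)) (∪-disjoint-⊆ B#S (⊆-reflexive (sym eq)))

  ∪-disjoint-≢ : ∀ {A S} → Nonempty A → Disjoint A S → A ∪ S ≢ S
  ∪-disjoint-≢ (z , z∈A) A#S eq = A#S z∈A (subst (z ∈ˢ_) eq (p⊆p∪q _ z∈A))

  three-members⇒3≤∣p∣ : ∀ {p : Subset m} {x y z} → x ∈ˢ p → y ∈ˢ p - x → z ∈ˢ p - x - y → 3 ≤ ∣ p ∣
  three-members⇒3≤∣p∣ {p} {x} {y} {z} x∈ y∈ z∈ = begin
    3                      ≤⟨ s≤s (s≤s (s≤s z≤n)) ⟩
    3 + ∣ p - x - y - z ∣  ≤⟨ s≤s (s≤s (x∈p⇒∣p-x∣<∣p∣ z∈)) ⟩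
    2 + ∣ p - x - y ∣      ≤⟨ s≤s (x∈p⇒∣p-x∣<∣p∣ y∈) ⟩
    1 + ∣ p - x ∣          ≤⟨ x∈p⇒∣p-x∣<∣p∣ x∈ ⟩
    ∣ p ∣                  ∎
    where open ≤-Reasoning

  ∣p∣≤2⇒⊆pair : ∀ {p : Subset m} {x} → x ∈ˢ p → ∣ p ∣ ≤ 2 →
               ∃ λ y → y ∈ˢ p × (∀ {z} → z ∈ˢ p → z ≡ x ⊎ z ≡ y)
  ∣p∣≤2⇒⊆pair {p} {x} x∈p ∣p∣≤2 with nonempty? (p - x)
  ... | no p-x-empty = x , x∈p , λ {z} z∈p →
    inj₁ (decidable-stable (z ≟ᶠ x) λ z≢x → p-x-empty (z , x∈p∧x≢y⇒x∈p-y z∈p z≢x))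
  ... | yes (y , y∈p-x) = y , p─q⊆p p _ y∈p-x , x-or-y
    where
    x-or-y : ∀ {z} → z ∈ˢ p → z ≡ x ⊎ z ≡ y
    x-or-y {z} z∈p with z ≟ᶠ x | z ≟ᶠ y
    ... | yes z≡x | _       = inj₁ z≡x
    ... | no  _   | yes z≡y = inj₂ z≡y
    ... | no  z≢x | no  z≢y = contradiction
      (three-members⇒3≤∣p∣ x∈p y∈p-x (x∈p∧x≢y⇒x∈p-y (x∈p∧x≢y⇒x∈p-y z∈p z≢x) z≢y))
      (<⇒≱ (s≤s ∣p∣≤2))

  _≟ˢ_ : DecidableEquality (Subset m)
  _≟ˢ_ = ≡-dec _≟ᵇ_

  ⊆-⋃ : ∀ {A} {G : List (Subset m)} → A ∈ G → A ⊆ ⋃ G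
  ⊆-⋃ {G = B ∷ G} (here refl) = p⊆p∪q (⋃ G)
  ⊆-⋃ {G = B ∷ G} (there A∈G) = q⊆p∪q B (⋃ G) ∘ ⊆-⋃ A∈G

  ∈-removeMinimal⁻ : ∀ {A} {G : List (Subset m)} → A ∈ removeMinimal G → A ∈ G × ∃ λ B → B ∈ G × B ⊂ A
  ∈-removeMinimal⁻ {A} {G} A∈ = ×-map₂ find (∈-filter⁻ (λ A → any? (λ B → B ⊂? A) G) A∈)

  heightAux-≤ : ∀ fuel (G : List (Subset m)) {k N} → (∀ {A} → A ∈ G → k ≤ ∣ A ∣) →
                (∀ {A} → A ∈ G → ∣ A ∣ ≤ N) → heightAux fuel G ≤ suc N ∸ k
  heightAux-≤ zero       _       _   _   = z≤n
  heightAux-≤ (suc fuel) []      _   _   = z≤n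
  heightAux-≤ (suc fuel) (A ∷ G) {k} {N} k≤ ≤N = begin
    suc (heightAux fuel (removeMinimal (A ∷ G)))  ≤⟨ s≤s (heightAux-≤ fuel _ suc-k≤ (≤N ∘ proj₁ ∘ ∈-removeMinimal⁻)) ⟩
    suc (N ∸ k)                                    ≡⟨ +-∸-assoc 1 (≤-trans (k≤ (here refl)) (≤N (here refl))) ⟨
    suc N ∸ k                                      ∎
    where
    open ≤-Reasoning
    suc-k≤ : ∀ {B} → B ∈ removeMinimal (A ∷ G) → suc k ≤ ∣ B ∣
    suc-k≤ B∈ with _ , C∈ , C⊂B ← proj₂ (∈-removeMinimal⁻ B∈) = ≤-<-trans (k≤ C∈) (p⊂q⇒∣p∣<∣q∣ C⊂B)

  height-≤ : ∀ {F : List (Subset m)} {k} → (∀ {A} → A ∈ F → k ≤ ∣ A ∣) → height F ≤ suc ∣ ⋃ F ∣ ∸ k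
  height-≤ {F} k≤ = heightAux-≤ (length F) F k≤ (p⊆q⇒∣p∣≤∣q∣ ∘ ⊆-⋃)

  small-member : ∀ {F : List (Subset m)} → F ≢ [] → ∣ ⋃ F ∣ ∸ 1 ≤ height F →
                 ∃ λ S → S ∈ F × ∣ S ∣ ≤ 2
  small-member {[]} F≢[] _ = contradiction refl F≢[]
  small-member {F@(_ ∷ _)} _ tall with any? (λ S → ∣ S ∣ ≤? 2) F
  ... | yes some = find some
  ... | no  none = contradiction tall (<⇒≱ (0<n≤m∸2⇒n<m∸1 {∣ ⋃ F ∣} (s≤s z≤n) (height-≤ 3≤)))
    where
    3≤ : ∀ {A} → A ∈ F → 3 ≤ ∣ A ∣
    3≤ A∈F = ≰⇒> (All.lookup (¬Any⇒All¬ F none) A∈F)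

module _ {m} {F : List (Subset m)} (F-∪-closed : UnionClosed F) (⊥∉F : ⊥ ∉ F) where

  member-nonempty : ∀ {A} → A ∈ F → Nonempty A
  member-nonempty {A} A∈F with nonempty? A
  ... | yes A≢∅ = A≢∅
  ... | no  A≡∅ = contradiction (subst (_∈ F) (Empty-unique A≡∅) A∈F) ⊥∉F

  disjoint<superset : ∀ {S L T} → S ∈ F → Unique L →
                      (∀ {A} → A ∈ L → A ∈ F × Disjoint A S) →
                      (∀ {A} → A ∈ F → S ⊆ A → A ∈ T) →
                      length L < length T
  disjoint<superset {S} {L} {T} S∈F L! L⊆F#S ⊇S⊆T = begin-strict
    length L                ≡⟨ length-map (_∪ S) L ⟨
    length (map (_∪ S) L)   <⟨ unique-⊆⇒length-≤ _≟ˢ_ (S∉images ∷ images!) S∷images⊆T ⟩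
    length T                ∎
    where
    open ≤-Reasoning
    images! : Unique (map (_∪ S) L)
    images! = unique-map⁺ (_∪ S)
      (λ A∈L B∈L → ∪-cancelʳ-disjoint (proj₂ (L⊆F#S A∈L)) (proj₂ (L⊆F#S B∈L))) L!
    S∉images : All (S ≢_) (map (_∪ S) L)
    S∉images = All-map⁺ (All.tabulate λ A∈L →
      let A∈F , A#S = L⊆F#S A∈L in ∪-disjoint-≢ (member-nonempty A∈F) A#S ∘ sym)
    S∷images⊆T : S ∷ map (_∪ S) L ⊆ₗ T
    S∷images⊆T (here refl) = ⊇S⊆T S∈F ⊆-refl
    S∷images⊆T (there B∈images) with A , A∈L , refl ← ∈-map⁻ (_∪ S) B∈images =
      ⊇S⊆T (F-∪-closed (proj₁ (L⊆F#S A∈L)) S∈F) (q⊆p∪q A S)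

  pair-member⇒length<degree-sum : ∀ {S x y} → S ∈ F → Unique F → x ∈ˢ S → y ∈ˢ S →
                        (∀ {z} → z ∈ˢ S → z ≡ x ⊎ z ≡ y) →
                        length F < degree x F + degree y F
  pair-member⇒length<degree-sum {S} {x} {y} S∈F F! x∈S y∈S S⊆xy =
    m+n≡o+p⇒n<p⇒o<m (length-filter-inclusion-exclusion x∈? y∈? F)
      (disjoint<superset S∈F (Unique.filter⁺ (neither? x∈? y∈?) F!) neither⊆F#S ⊇S⊆both)
    where
    x∈? : Decidable (x ∈ˢ_)
    x∈? = x ∈?_
    y∈? : Decidable (y ∈ˢ_)
    y∈? = y ∈?_
    neither⊆F#S : ∀ {A} → A ∈ filter (neither? x∈? y∈?) F → A ∈ F × Disjoint A S
    neither⊆F#S {A} A∈ with A∈F , x∉A , y∉A ← ∈-filter⁻ (neither? x∈? y∈?) A∈ = A∈F , A#S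
      where
      A#S : Disjoint A S
      A#S z∈A z∈S with S⊆xy z∈S
      ... | inj₁ refl = x∉A z∈A
      ... | inj₂ refl = y∉A z∈A
    ⊇S⊆both : ∀ {A} → A ∈ F → S ⊆ A → A ∈ filter (both? x∈? y∈?) F
    ⊇S⊆both A∈F S⊆A = ∈-filter⁺ (both? x∈? y∈?) A∈F (S⊆A x∈S , S⊆A y∈S)

proposition3p4p1 : ∀ (m : ℕ) (F : List (Subset m)) →
    Unique F → F ≢ [] → UnionClosed F → ⊥ ∉ F →
    ∣ ⋃ F ∣ ∸ 1 ≤ height F →
    ∃ λ (x : Fin m) → length F < 2 * degree x F
proposition3p4p1 m F F! F≢[] F-∪-closed ⊥∉F tall =
  let S , S∈F , ∣S∣≤2  = small-member F≢[] tall
      x , x∈S         = member-nonempty F-∪-closed ⊥∉F S∈F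
      y , y∈S , S⊆xy  = ∣p∣≤2⇒⊆pair x∈S ∣S∣≤2
  in  [ (x ,_) , (y ,_) ]′ (<+⇒<2*⊎<2* (degree x F) (degree y F)
        (pair-member⇒length<degree-sum F-∪-closed ⊥∉F S∈F F! x∈S y∈S S⊆xy))
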